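{- Let $\mathcal{F}\subseteq\omega^\omega$ be a maximal eventually different family. Then $\mathcal{I}_0(\mathcal{F})$ is an ideal on $\omega$ that contains all finite sets and does not contain $\omega$.
   Context: Functions $f,g$ with common domain $A\subseteq\omega$ are eventually different if they agree on only finitely many points of $A$; an eventually different (e.d.) family is one whose distinct members are pairwise eventually different; it is maximal (m.e.d.) if maximal under inclusion among e.d. families of functions $A\to\omega$. For $\mathcal{F}\subseteq\omega^\omega$ and infinite $A\subseteq\omega$ let $\mathcal{F}\restriction A=\{f\restriction A: f\in\mathcal{F}\}$. Define $\mathcal{I}_0(\mathcal{F}) := \{A\subseteq\omega \text{ infinite} : \mathcal{F}\restriction A \text{ is not a m.e.d. family of functions } A\to\omega\}\cup\mathrm{Fin}$, where $\mathrm{Fin}$ is the set of finite subsets of $\omega$. -}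

module Defs where

open import Level using (0ℓ; suc)
open import Data.Bool using (Bool; true; false; T; _∨_)
open import Data.Nat using (ℕ; _≤_)
open import Data.Product using (Σ; ∃; _×_; _,_)
open import Data.Sum using (_⊎_)
open import Relation.Nullary using (¬_)
open import Relation.Binary.PropositionalEquality using (_≡_)

Subset : Set
Subset = ℕ → Bool

_∈_ : ℕ → Subset → Set
n ∈ A = T (A n)

ω : Subset
ω _ = true

_∪_ : Subset → Subset → Subset
(A ∪ B) n = A n ∨ B n

_⊆_ : Subset → Subset → Set
A ⊆ B = ∀ n → n ∈ A → n ∈ B

FinitePred : (ℕ → Set) → Set
FinitePred P = ∃ λ N → ∀ n → N ≤ n → ¬ P n

Finite : Subset → Set
Finite A = FinitePred (λ n → n ∈ A)

Infinite : Subset → Set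
Infinite A = ¬ Finite A

-- Functions A → ω are represented by functions ℕ → ℕ, considered only
-- through their values on A (i.e. up to the equivalence EqOn A).
EqOn : Subset → (ℕ → ℕ) → (ℕ → ℕ) → Set
EqOn A f g = ∀ n → n ∈ A → f n ≡ g n

EventuallyDifferent : Subset → (ℕ → ℕ) → (ℕ → ℕ) → Set
EventuallyDifferent A f g = FinitePred (λ n → n ∈ A × f n ≡ g n)

Family : Set₁
Family = (ℕ → ℕ) → Set

_⊆F[_]_ : Family → Subset → Family → Set
G ⊆F[ A ] H = ∀ f → G f → ∃ λ g → H g × EqOn A f g

IsED : Subset → Family → Set
IsED A G = ∀ f g → G f → G g → ¬ EqOn A f g → EventuallyDifferent A f g

IsMED : Subset → Family → Set₁
IsMED A G = IsED A G × (∀ H → IsED A H → G ⊆F[ A ] H → H ⊆F[ A ] G)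

_↾_ : Family → Subset → Family
(F ↾ A) h = ∃ λ f → F f × EqOn A h f

I₀ : Family → Subset → Set₁
I₀ F A = (Infinite A × ¬ IsMED A (F ↾ A)) ⊎ Finite A

IsIdeal : (Subset → Set₁) → Set₁
IsIdeal I = (∀ A B → A ⊆ B → I B → I A) × (∀ A B → I A → I B → I (A ∪ B))

-- A ∈ I₀(F) exactly when A is finite or some h : A → ω is eventually
-- different from every member of F on A: an infinite A for which F ↾ A is
-- not maximal admits such an h by maximality, and conversely such an h can
-- be added to F ↾ A, which is then not maximal since A is infinite.  Such
-- "escaping" functions pass to subsets, and two of them (on A and on B) can
-- be glued into one on A ∪ B; on ω no function escapes because F is m.e.d.
module Submission where

open import Defs
open import Level using (0ℓ; suc; lift; lower)
open import Axiom.ExcludedMiddle using (ExcludedMiddle)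
open import Data.Bool using (true; false; if_then_else_)
open import Data.Empty using (⊥-elim)
open import Data.Nat using (ℕ; _⊔_)
open import Data.Nat.Properties using (≤-refl; ≤-trans; m≤m⊔n; m≤n⊔m)
open import Data.Product using (_×_; _,_; ∃)
open import Data.Sum using (_⊎_; inj₁; inj₂; [_,_])
open import Data.Unit using (tt)
open import Relation.Nullary using (¬_; Dec; yes; no)
open import Relation.Nullary.Decidable using (map′)
open import Relation.Binary.PropositionalEquality using (_≡_; refl; sym; trans)

decide : ExcludedMiddle (suc 0ℓ) → (P : Set) → Dec P
decide em P = map′ lower lift em

finitePred-mono : {P Q : ℕ → Set} → (∀ n → Q n → P n) →
                  FinitePred P → FinitePred Q
finitePred-mono Q⇒P (N , ¬P) = N , λ n N≤n q → ¬P n N≤n (Q⇒P n q)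

finitePred-⊎ : {P Q R : ℕ → Set} → (∀ n → R n → P n ⊎ Q n) →
               FinitePred P → FinitePred Q → FinitePred R
finitePred-⊎ R⇒P⊎Q (M , ¬P) (N , ¬Q) = M ⊔ N , λ n M⊔N≤n r →
  [ ¬P n (≤-trans (m≤m⊔n M N) M⊔N≤n) , ¬Q n (≤-trans (m≤n⊔m M N) M⊔N≤n) ]
    (R⇒P⊎Q n r)

module _ {A : Subset} {f g : ℕ → ℕ} where

  ed-sym : EventuallyDifferent A f g → EventuallyDifferent A g f
  ed-sym = finitePred-mono λ _ (n∈A , eq) → n∈A , sym eq

  ed-respʳ : ∀ {g′} → EqOn A g g′ →
             EventuallyDifferent A f g → EventuallyDifferent A f g′
  ed-respʳ g≗g′ = finitePred-mono λ n (n∈A , eq) → n∈A , trans eq (sym (g≗g′ n n∈A))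

  ed-⊆ : ∀ {B} → A ⊆ B → EventuallyDifferent B f g → EventuallyDifferent A f g
  ed-⊆ A⊆B = finitePred-mono λ n (n∈A , eq) → A⊆B n n∈A , eq

  ed∧eqOn⇒finite : EqOn A f g → EventuallyDifferent A f g → Finite A
  ed∧eqOn⇒finite f≗g = finitePred-mono λ n n∈A → n∈A , f≗g n n∈A

eqOn-sym : ∀ {A f g} → EqOn A f g → EqOn A g f
eqOn-sym f≗g n n∈A = sym (f≗g n n∈A)

eqOn-trans : ∀ {A f g h} → EqOn A f g → EqOn A g h → EqOn A f h
eqOn-trans f≗g g≗h n n∈A = trans (f≗g n n∈A) (g≗h n n∈A)

↾-member : ∀ {F A f} → F f → (F ↾ A) f
↾-member Ff = _ , Ff , λ _ _ → refl

isED-↾ : ∀ {F} A → IsED ω F → IsED A (F ↾ A)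
isED-↾ A edF k k′ (f , Ff , k≗f) (f′ , Ff′ , k′≗f′) k≉k′ =
  ed-sym (ed-respʳ (eqOn-sym k≗f)
    (ed-sym (ed-respʳ (eqOn-sym k′≗f′) (ed-⊆ (λ _ _ → tt) (edF f f′ Ff Ff′ f≉f′)))))
  where
  f≉f′ : ¬ EqOn ω f f′
  f≉f′ f≗f′ = k≉k′ (eqOn-trans k≗f (eqOn-trans (λ n _ → f≗f′ n tt) (eqOn-sym k′≗f′)))

isMED-↾ω : ∀ {F} → IsMED ω F → IsMED ω (F ↾ ω)
isMED-↾ω (edF , maxF) = isED-↾ ω edF , λ H edH F↾ω⊆H h Hh →
  let g , Fg , h≗g = maxF H edH (λ f Ff → F↾ω⊆H f (↾-member Ff)) h Hh
  in g , ↾-member Fg , h≗g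

Escapes : Subset → Family → (ℕ → ℕ) → Set
Escapes A F h = ∀ f → F f → EventuallyDifferent A h f

Escapable : Family → Subset → Set
Escapable F A = ∃ (Escapes A F)

finite⇒escapable : ∀ {F A} → Finite A → Escapable F A
finite⇒escapable A-fin =
  (λ _ → 0) , λ _ _ → finitePred-mono (λ _ (n∈A , _) → n∈A) A-fin

escapable-⊆ : ∀ {F A B} → A ⊆ B → Escapable F B → Escapable F A
escapable-⊆ A⊆B (h , h-esc) = h , λ f Ff → ed-⊆ A⊆B (h-esc f Ff)

escapable-∪ : ∀ {F} A B → Escapable F A → Escapable F B → Escapable F (A ∪ B)
escapable-∪ {F} A B (hA , hA-esc) (hB , hB-esc) =
  h , λ f Ff → finitePred-⊎ (split f) (hA-esc f Ff) (hB-esc f Ff)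
  where
  h : ℕ → ℕ
  h n = if A n then hA n else hB n

  split : ∀ f n → n ∈ (A ∪ B) × h n ≡ f n →
          (n ∈ A × hA n ≡ f n) ⊎ (n ∈ B × hB n ≡ f n)
  split f n with A n
  ... | true  = λ (_ , eq) → inj₁ (tt , eq)
  ... | false = λ (n∈B , eq) → inj₂ (n∈B , eq)

-- Members of H that agree on A with no member of F ↾ A escape F, because
-- each member of F agrees on A with some member of H.
¬isMED-↾⇒escapable : ExcludedMiddle (suc 0ℓ) → ∀ {F} A → IsED ω F →
                      ¬ IsMED A (F ↾ A) → Escapable F A
¬isMED-↾⇒escapable em {F} A edF ¬med with decide em (Escapable F A)
... | yes esc = esc
... | no ¬esc = ⊥-elim (¬med (isED-↾ A edF , maximal))
  where
  maximal : ∀ H → IsED A H → (F ↾ A) ⊆F[ A ] H → H ⊆F[ A ] (F ↾ A)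
  maximal H edH F↾A⊆H h Hh with decide em (∃ λ g → (F ↾ A) g × EqOn A h g)
  ... | yes covered = covered
  ... | no ¬covered = ⊥-elim (¬esc (h , h-esc))
    where
    h-esc : Escapes A F h
    h-esc f Ff =
      let g , Hg , f≗g = F↾A⊆H f (↾-member Ff)
          h≉g h≗g = ¬covered (f , ↾-member Ff , eqOn-trans h≗g (eqOn-sym f≗g))
      in ed-respʳ (eqOn-sym f≗g) (edH h g Hh Hg h≉g)

escapable⇒¬isMED-↾ : ∀ {F A} → Infinite A → Escapable F A → ¬ IsMED A (F ↾ A)
escapable⇒¬isMED-↾ {F} {A} A-inf (h , h-esc) (edA , maxA)
  with maxA F↾A+h edF↾A+h (λ f F↾Af → f , inj₁ F↾Af , λ _ _ → refl) h (inj₂ λ _ _ → refl)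
  where
  F↾A+h : Family
  F↾A+h k = (F ↾ A) k ⊎ EqOn A k h

  escapes-↾ : ∀ k k′ → (F ↾ A) k → EqOn A k′ h → EventuallyDifferent A k k′
  escapes-↾ k k′ (f , Ff , k≗f) k′≗h =
    ed-sym (ed-respʳ (eqOn-sym k≗f)
      (finitePred-mono (λ n (n∈A , eq) → n∈A , trans (sym (k′≗h n n∈A)) eq) (h-esc f Ff)))

  edF↾A+h : IsED A F↾A+h
  edF↾A+h k k′ (inj₁ x) (inj₁ y) k≉k′ = edA k k′ x y k≉k′
  edF↾A+h k k′ (inj₁ x) (inj₂ y) _    = escapes-↾ k k′ x y
  edF↾A+h k k′ (inj₂ x) (inj₁ y) _    = ed-sym (escapes-↾ k′ k y x)
  edF↾A+h k k′ (inj₂ x) (inj₂ y) k≉k′ = ⊥-elim (k≉k′ (eqOn-trans x (eqOn-sym y)))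
... | g , (f , Ff , g≗f) , h≗g =
  A-inf (ed∧eqOn⇒finite (eqOn-trans h≗g g≗f) (h-esc f Ff))

I₀⇒escapable : ExcludedMiddle (suc 0ℓ) → ∀ {F} A → IsED ω F → I₀ F A → Escapable F A
I₀⇒escapable em A edF (inj₁ (_ , ¬med)) = ¬isMED-↾⇒escapable em A edF ¬med
I₀⇒escapable em A edF (inj₂ A-fin)      = finite⇒escapable A-fin

escapable⇒I₀ : ExcludedMiddle (suc 0ℓ) → ∀ {F} A → Escapable F A → I₀ F A
escapable⇒I₀ em A esc with decide em (Finite A)
... | yes A-fin = inj₂ A-fin
... | no A-inf  = inj₁ (A-inf , escapable⇒¬isMED-↾ A-inf esc)

¬I₀ω : ∀ {F} → IsMED ω F → ¬ I₀ F ω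
¬I₀ω medF (inj₁ (_ , ¬med))  = ¬med (isMED-↾ω medF)
¬I₀ω medF (inj₂ (N , ¬N∈ω)) = ¬N∈ω N ≤-refl tt

proposition5p2 : ExcludedMiddle (suc 0ℓ) → (F : Family) → IsMED ω F →
    IsIdeal (I₀ F) × (∀ A → Finite A → I₀ F A) × ¬ I₀ F ω
proposition5p2 em F medF@(edF , _) =
  (downward-closed , union-closed) , (λ _ → inj₂) , ¬I₀ω medF
  where
  downward-closed : ∀ A B → A ⊆ B → I₀ F B → I₀ F A
  downward-closed A B A⊆B B∈I₀ =
    escapable⇒I₀ em A (escapable-⊆ A⊆B (I₀⇒escapable em B edF B∈I₀))

  union-closed : ∀ A B → I₀ F A → I₀ F B → I₀ F (A ∪ B)
  union-closed A B A∈I₀ B∈I₀ = escapable⇒I₀ em (A ∪ B)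
    (escapable-∪ A B (I₀⇒escapable em A edF A∈I₀) (I₀⇒escapable em B edF B∈I₀))
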